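{- Let $(G,k)$ be an instance of Annotated Weighted Edge Clique Partition (AWECP) with no isolated vertices, and let $D$ be a block of $G$ with $|D| = t \geq k+1$ vertices. If $(G,k)$ is a YES-instance, then $D$ is an identical block; that is, there is no solution in which two vertices of $D$ have distinct signatures.
   Context: An instance of AWECP consists of a graph $G=(V,E)$ with non-negative integer edge weights $w_e$ ($e\in E$), a set $S\subseteq V$ of annotated vertices with non-negative integer weights $w_v$ ($v\in S$), and a positive integer $k$. A solution is a multiset of at most $k$ cliques $C_1,\dots,C_k$ of $G$ (each of weight $1$) such that every edge $uv\in E$ lies in exactly $w_{uv}$ of the cliques and every $v\in S$ lies in exactly $w_v$ of the cliques; $(G,k)$ is a YES-instance if a solution exists. Following the paper's convention, solutions are taken to contain no clique of size $1$. The signature of a vertex $u$ in a solution is the 0/1 vector $B_u\in\{0,1\}^k$ with $B_{u,j}=1$ iff $u\in C_j$. Let $A$ be the symmetric $|V|\times|V|$ matrix with $A_{uv}=w_{uv}$ if $uv\in E$, $A_{uv}=0$ if $u\ne v$ and $uv\notin E$, $A_{vv}=w_v$ for $v\in S$ and $A_{vv}=\star$ (a wildcard) for $v\notin S$. For $a,b\in\mathbb{R}\cup\{\star\}$ write $a\stackrel{\star}{=}b$ if $a=b$, $a=\star$ or $b=\star$; for rows, $A_u\stackrel{\star}{=}A_v$ means entrywise. Two distinct vertices $u,v$ are $\star$-twins if they are adjacent and $A_u\stackrel{\star}{=}A_v$. The vertices are partitioned into blocks, where distinct $u,v$ are in the same block iff they are $\star$-twins (this is an equivalence relation). For a YES-instance,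 a block is identical if its vertices are $\star$-twins $u,v$ such that no solution gives $u$ and $v$ distinct signatures (equivalently, in every solution all vertices of the block have the same signature). -}

module Defs where

open import Data.Nat using (ℕ; suc; _≤_)
open import Data.Bool using (Bool; true; false; _∧_; if_then_else_)
open import Data.Fin using (Fin; _≟_)
open import Data.Fin.Subset using (Subset; ∣_∣)
open import Data.Vec using (lookup; tabulate)
open import Data.Maybe using (Maybe; just; nothing)
open import Data.Product using (Σ; ∃; _×_)
open import Data.Sum using (_⊎_)
open import Relation.Nullary using (¬_; yes; no)
open import Relation.Binary.PropositionalEquality using (_≡_; _≢_)

-- An AWECP instance on the vertex set Fin n.
-- adj    : adjacency (simple graph: symmetric, irreflexive)
-- w      : edge weights (only read on edges; symmetric)
-- ann    : just w_v for annotated v ∈ S, nothing for v ∉ S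
record Instance (n : ℕ) : Set where
  field
    adj      : Fin n → Fin n → Bool
    adj-sym  : ∀ u v → adj u v ≡ adj v u
    adj-irr  : ∀ u → adj u u ≡ false
    w        : Fin n → Fin n → ℕ
    w-sym    : ∀ u v → w u v ≡ w v u
    ann      : Fin n → Maybe ℕ

module _ {n : ℕ} (I : Instance n) where
  open Instance I

  IsClique : Subset n → Set
  IsClique C = ∀ u v → u ≢ v → lookup C u ≡ true → lookup C v ≡ true → adj u v ≡ true

  -- A solution: k slots C_1..C_k. A slot is either empty (padding, so that
  -- "at most k cliques" is represented by exactly k slots) or a clique of size ≥ 2
  -- (no cliques of size 1, per the paper's convention).
  both : {k : ℕ} → (Fin k → Subset n) → Fin n → Fin n → ℕ
  both C u v = ∣ tabulate (λ j → lookup (C j) u ∧ lookup (C j) v) ∣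

  occ : {k : ℕ} → (Fin k → Subset n) → Fin n → ℕ
  occ C v = ∣ tabulate (λ j → lookup (C j) v) ∣

  IsSolution : (k : ℕ) → (Fin k → Subset n) → Set
  IsSolution k C =
      (∀ j → IsClique (C j))
    × (∀ j → ∣ C j ∣ ≢ 1)
    × (∀ u v → adj u v ≡ true → both C u v ≡ w u v)
    × (∀ v m → ann v ≡ just m → occ C v ≡ m)

  YES : ℕ → Set
  YES k = Σ (Fin k → Subset n) (IsSolution k)

  -- the matrix A, with ⋆ represented by nothing
  A : Fin n → Fin n → Maybe ℕ
  A u v with u ≟ v
  ... | yes _ = ann u
  ... | no _  = if adj u v then just (w u v) else just 0

  _≐⋆_ : Maybe ℕ → Maybe ℕ → Set
  a ≐⋆ b = (a ≡ b) ⊎ (a ≡ nothing) ⊎ (b ≡ nothing)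

  StarTwins : Fin n → Fin n → Set
  StarTwins u v = u ≢ v × adj u v ≡ true × (∀ x → A u x ≐⋆ A v x)

  IsBlock : Subset n → Set
  IsBlock D = ∃ λ r → ∀ v → ((lookup D v ≡ true) → (v ≡ r ⊎ StarTwins r v))
                           × ((v ≡ r ⊎ StarTwins r v) → lookup D v ≡ true)

  NoIsolated : Set
  NoIsolated = ∀ u → ∃ λ v → adj u v ≡ true

  -- signature of u in solution C is j ↦ lookup (C j) u.
  -- D is identical: in every solution all vertices of D have the same signature.
  Identical : (k : ℕ) → Subset n → Set
  Identical k D = ∀ (C : Fin k → Subset n) → IsSolution k C →
    ∀ u v → lookup D u ≡ true → lookup D v ≡ true →
    ∀ j → lookup (C j) u ≡ lookup (C j) v

-- Fix a solution and let B_x ⊆ {1..k} be the signature of x. Vertices of a block are ⋆-twins of a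
-- common root, so |B_x ∩ B_z| = |B_y ∩ B_z| whenever x, y ∈ D and z ∉ {x, y}; it follows that
-- |B_x ∩ B_y| = c for all distinct x, y ∈ D. If every B_x (x ∈ D) had more than c elements, the Gram
-- matrix of their incidence vectors would be cJ plus a positive diagonal, hence nonsingular, and
-- |D| > k vectors of ℤ^k would be linearly independent (Fisher's inequality). So some x ∈ D has
-- |B_x| ≤ c, which forces B_x ⊆ B_y for all y ∈ D. A slot j ∈ B_y ∖ B_x is a clique of size ≥ 2,
-- so it contains some z ≠ y, and then |B_x ∩ B_z| < |B_y ∩ B_z|, contradicting the twin property.

module Submission where

open import Defs

open import Data.Bool using (Bool; true; false; _∧_; if_then_else_)
open import Data.Empty using (⊥)
open import Data.Fin using (Fin; zero; suc; _≟_)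
open import Data.Fin.Properties using (any?; suc-injective)
open import Data.Fin.Subset
  using (Subset; _∈_; _∉_; _⊆_; _∩_; _-_; ∣_∣; Nonempty; Empty; inside; outside)
open import Data.Fin.Subset.Properties
  using (_∈?_; nonempty?; Empty-unique; ∣⊥∣≡0; p─q⊆p; p─⊥≡p; ⊆-antisym; p⊂q⇒∣p∣<∣q∣;
         p∩q⊆p; x∈p∩q⁺; x∈p∩q⁻; ∩-comm; ∩-idem)
open import Data.Integer as ℤ using (ℤ; +_; +0; +[1+_]; -[1+_]; -_; 0ℤ; 1ℤ; _+_; _*_)
import Data.Integer.Properties as ℤ
open import Algebra.Properties.Semiring.Sum ℤ.+-*-semiring
  using (sum-syntax; sum-cong-≗; ∑-comm; ∑-distrib-+; *-distribˡ-sum; sum-replicate-zero)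
open import Data.Integer.Tactic.RingSolver using (solve-∀)
open import Data.Maybe using (just)
open import Data.Maybe.Properties using (just-injective)
open import Data.Nat as ℕ using (ℕ; zero; suc; _≤_; _<_; _≤?_)
import Data.Nat.Properties as ℕ
open import Data.Product using (∃; _×_; _,_; proj₁; proj₂)
open import Data.Sum using (inj₁; inj₂; [_,_]′)
open import Data.Vec using ([]; _∷_; here; there; lookup; tabulate)
open import Data.Vec.Properties using (lookup∘tabulate; []=⇒lookup; lookup⇒[]=)
open import Function using (_∘_; id)
open import Relation.Nullary using (yes; no; does; ¬?; contradiction)
open import Relation.Nullary.Decidable using (_×-dec_)
open import Relation.Binary.PropositionalEquality

∣p∣≡1+∣p-x∣ : ∀ {n} {p : Subset n} {x} → x ∈ p → ∣ p ∣ ≡ suc ∣ p - x ∣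
∣p∣≡1+∣p-x∣ {p = inside ∷ p} here = cong (suc ∘ ∣_∣) (sym (p─⊥≡p p))
∣p∣≡1+∣p-x∣ {p = inside ∷ p} (there x∈p) = cong suc (∣p∣≡1+∣p-x∣ x∈p)
∣p∣≡1+∣p-x∣ {p = outside ∷ p} (there x∈p) = ∣p∣≡1+∣p-x∣ x∈p

x∈p-y⇒x≢y : ∀ {n} {p : Subset n} {x y} → x ∈ p - y → x ≢ y
x∈p-y⇒x≢y {p = _ ∷ p} {suc x} {suc y} (there x∈p-y) refl = x∈p-y⇒x≢y x∈p-y refl

∣p∣>0⇒nonempty : ∀ {n} (p : Subset n) → 0 ℕ.< ∣ p ∣ → Nonempty p
∣p∣>0⇒nonempty {n} p ∣p∣>0 with nonempty? p
... | yes p≠∅ = p≠∅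
... | no p=∅ = contradiction (trans (cong ∣_∣ (Empty-unique p=∅)) (∣⊥∣≡0 n)) (ℕ.>⇒≢ ∣p∣>0)

∃-other-element : ∀ {n} {p : Subset n} {x} → x ∈ p → ∣ p ∣ ≢ 1 → ∃ λ y → y ∈ p × y ≢ x
∃-other-element {p = p} {x} x∈p ∣p∣≢1 with ∣p∣>0⇒nonempty (p - x) (ℕ.n≢0⇒n>0 ∣p-x∣≢0)
  where
  ∣p-x∣≢0 : ∣ p - x ∣ ≢ 0
  ∣p-x∣≢0 ∣p-x∣≡0 = ∣p∣≢1 (trans (∣p∣≡1+∣p-x∣ x∈p) (cong suc ∣p-x∣≡0))
... | y , y∈p-x = y , p─q⊆p p _ y∈p-x , x∈p-y⇒x≢y y∈p-x

∣p∣≤∣p∩q∣⇒p⊆q : ∀ {k} {p q : Subset k} → ∣ p ∣ ≤ ∣ p ∩ q ∣ → p ⊆ q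
∣p∣≤∣p∩q∣⇒p⊆q {p = p} {q} ∣p∣≤∣p∩q∣ {x} x∈p with x ∈? q
... | yes x∈q = x∈q
... | no x∉q = contradiction ∣p∣≤∣p∩q∣ (ℕ.<⇒≱ (p⊂q⇒∣p∣<∣q∣ (p∩q⊆p p q , x , x∈p , x∉q ∘ proj₂ ∘ x∈p∩q⁻ p q)))

p⊆q⇒p∩r⊆q∩r : ∀ {k} {p q : Subset k} r → p ⊆ q → p ∩ r ⊆ q ∩ r
p⊆q⇒p∩r⊆q∩r {p = p} r p⊆q x∈p∩r with x∈p∩q⁻ p r x∈p∩r
... | x∈p , x∈r = x∈p∩q⁺ (p⊆q x∈p , x∈r)

⟨_,_⟩ : ∀ {k} → (Fin k → ℤ) → (Fin k → ℤ) → ℤ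
⟨_,_⟩ {k} u v = ∑[ j < k ] (u j * v j)

δ : ∀ {n} → Fin n → Fin n → ℤ
δ y x = if does (x ≟ y) then 1ℤ else 0ℤ

δ-refl : ∀ {n} (y : Fin n) → δ y y ≡ 1ℤ
δ-refl y with y ≟ y
... | yes _ = refl
... | no y≢y = contradiction refl y≢y

δ-≢ : ∀ {n} {x y : Fin n} → x ≢ y → δ y x ≡ 0ℤ
δ-≢ {x = x} {y} x≢y with x ≟ y
... | yes x≡y = contradiction x≡y x≢y
... | no _ = refl

∑-zero : ∀ {n} (f : Fin n → ℤ) → (∀ i → f i ≡ 0ℤ) → ∑[ i < n ] f i ≡ 0ℤ
∑-zero {n} f f≡0 = trans (sum-cong-≗ f≡0) (sum-replicate-zero n)

∑-single : ∀ {n} (f : Fin n → ℤ) y → (∀ x → x ≢ y → f x ≡ 0ℤ) → ∑[ x < n ] f x ≡ f y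
∑-single {suc n} f zero f≡0 =
  trans (cong (λ t → f zero + t) (∑-zero (f ∘ suc) (λ x → f≡0 (suc x) λ ()))) (ℤ.+-identityʳ (f zero))
∑-single {suc n} f (suc y) f≡0 =
  trans (cong₂ _+_ (f≡0 zero λ ()) (∑-single (f ∘ suc) y (λ x x≢y → f≡0 (suc x) (x≢y ∘ suc-injective))))
        (ℤ.+-identityˡ (f (suc y)))

∑-δ : ∀ {n} y (f : Fin n → ℤ) → ∑[ x < n ] (δ y x * f x) ≡ f y
∑-δ {n} y f = begin
  ∑[ x < n ] (δ y x * f x) ≡⟨ ∑-single _ y (λ x x≢y → cong (_* f x) (δ-≢ x≢y)) ⟩
  δ y y * f y              ≡⟨ cong (_* f y) (δ-refl y) ⟩
  1ℤ * f y                 ≡⟨ ℤ.*-identityˡ (f y) ⟩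
  f y                      ∎
  where open ≡-Reasoning

∑-linear : ∀ {n} a b (f g : Fin n → ℤ) →
  ∑[ x < n ] (a * f x + b * g x) ≡ a * (∑[ x < n ] f x) + b * (∑[ x < n ] g x)
∑-linear a b f g =
  trans (∑-distrib-+ (λ x → a * f x) (λ x → b * g x)) (sym (cong₂ _+_ (*-distribˡ-sum a f) (*-distribˡ-sum b g)))

∑-nonpos : ∀ {n} (f : Fin n → ℤ) → (∀ i → f i ℤ.≤ 0ℤ) → ∑[ i < n ] f i ℤ.≤ 0ℤ
∑-nonpos {zero} f _ = ℤ.≤-refl
∑-nonpos {suc n} f f≤0 = ℤ.+-mono-≤ (f≤0 zero) (∑-nonpos (f ∘ suc) (f≤0 ∘ suc))

∑-⟨⟩-annihilated : ∀ {n k} (l : Fin n → ℤ) (V : Fin n → Fin k → ℤ) →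
  (∀ j → ∑[ x < n ] (l x * V x j) ≡ 0ℤ) → ∀ w → ∑[ x < n ] (l x * ⟨ V x , w ⟩) ≡ 0ℤ
∑-⟨⟩-annihilated {n} {k} l V l·V≡0 w = begin
  ∑[ x < n ] (l x * ⟨ V x , w ⟩)            ≡⟨ sum-cong-≗ (λ x → *-distribˡ-sum (l x) (λ j → V x j * w j)) ⟩
  ∑[ x < n ] ∑[ j < k ] (l x * (V x j * w j)) ≡⟨ sum-cong-≗ (λ x → sum-cong-≗ (λ j → reorder (l x) (V x j) (w j))) ⟩
  ∑[ x < n ] ∑[ j < k ] (w j * (l x * V x j)) ≡⟨ ∑-comm (λ x j → w j * (l x * V x j)) ⟩
  ∑[ j < k ] ∑[ x < n ] (w j * (l x * V x j)) ≡⟨ sum-cong-≗ (λ j → sym (*-distribˡ-sum (w j) (λ x → l x * V x j))) ⟩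
  ∑[ j < k ] (w j * ∑[ x < n ] (l x * V x j)) ≡⟨ ∑-zero (λ j → w j * ∑[ x < n ] (l x * V x j)) w*0≡0 ⟩
  0ℤ                                          ∎
  where
  open ≡-Reasoning
  w*0≡0 : ∀ j → w j * ∑[ x < n ] (l x * V x j) ≡ 0ℤ
  w*0≡0 j = trans (cong (w j *_) (l·V≡0 j)) (ℤ.*-zeroʳ (w j))
  reorder : ∀ a b c → a * (b * c) ≡ c * (a * b)
  reorder = solve-∀

record LinearDependence {n k} (V : Fin n → Fin k → ℤ) (D : Subset n) : Set where
  field
    coeff          : Fin n → ℤ
    coeff-outside  : ∀ {x} → x ∉ D → coeff x ≡ 0ℤ
    witness        : Fin n
    witness∈D      : witness ∈ D
    coeff-witness≢0 : coeff witness ≢ 0ℤ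
    annihilates    : ∀ j → ∑[ x < n ] (coeff x * V x j) ≡ 0ℤ

dependence-of-point : ∀ {n} (V : Fin n → Fin 0 → ℤ) {D x} → x ∈ D → LinearDependence V D
dependence-of-point V {x = x} x∈D = record
  { coeff           = δ x
  ; coeff-outside   = λ {y} y∉D → δ-≢ {x = y} λ { refl → y∉D x∈D }
  ; witness         = x
  ; witness∈D       = x∈D
  ; coeff-witness≢0 = λ δxx≡0 → contradiction (trans (sym (δ-refl x)) δxx≡0) λ ()
  ; annihilates     = λ ()
  }

dependence-with-zero-column : ∀ {n k} (V : Fin n → Fin (suc k) → ℤ) {D} →
  (∀ {x} → x ∈ D → V x zero ≡ 0ℤ) → LinearDependence (λ x j → V x (suc j)) D → LinearDependence V D
dependence-with-zero-column {n} V {D} V₀≡0 dep = record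
  { coeff           = coeff
  ; coeff-outside   = coeff-outside
  ; witness         = witness
  ; witness∈D       = witness∈D
  ; coeff-witness≢0 = coeff-witness≢0
  ; annihilates     = λ { zero → ∑-zero _ term₀≡0 ; (suc j) → annihilates j }
  }
  where
  open LinearDependence dep
  term₀≡0 : ∀ x → coeff x * V x zero ≡ 0ℤ
  term₀≡0 x with x ∈? D
  ... | yes x∈D = trans (cong (coeff x *_) (V₀≡0 x∈D)) (ℤ.*-zeroʳ (coeff x))
  ... | no x∉D = cong (_* V x zero) (coeff-outside x∉D)

module _ {n k} (V : Fin n → Fin (suc k) → ℤ) {D : Subset n} {x₀}
  (x₀∈D : x₀ ∈ D) (a≢0 : V x₀ zero ≢ 0ℤ) where

  private
    a : ℤ
    a = V x₀ zero

  eliminate-first-column : Fin n → Fin k → ℤ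
  eliminate-first-column x j = a * V x (suc j) ℤ.- V x zero * V x₀ (suc j)

  dependence-after-elimination : LinearDependence eliminate-first-column (D - x₀) → LinearDependence V D
  dependence-after-elimination dep = record
    { coeff           = l
    ; coeff-outside   = l-outside
    ; witness         = witness
    ; witness∈D       = p─q⊆p D _ witness∈D
    ; coeff-witness≢0 = l-witness≢0
    ; annihilates     = l-annihilates
    }
    where
    open LinearDependence dep renaming (coeff to μ)
    T : ℤ
    T = ∑[ x < n ] (μ x * V x zero)
    l : Fin n → ℤ
    l x = a * μ x + δ x₀ x * - T

    l-outside : ∀ {x} → x ∉ D → l x ≡ 0ℤ
    l-outside {x} x∉D = begin
      a * μ x + δ x₀ x * - T ≡⟨ cong₂ (λ m d → a * m + d * - T)
                                  (coeff-outside (x∉D ∘ p─q⊆p D _)) (δ-≢ {x = x} λ { refl → x∉D x₀∈D }) ⟩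
      a * 0ℤ + 0ℤ * - T      ≡⟨ zeroes a T ⟩
      0ℤ                     ∎
      where
      open ≡-Reasoning
      zeroes : ∀ a T → a * 0ℤ + 0ℤ * - T ≡ 0ℤ
      zeroes = solve-∀

    l-witness≢0 : l witness ≢ 0ℤ
    l-witness≢0 lw≡0 with ℤ.i*j≡0⇒i≡0∨j≡0 a (trans (sym l-witness) lw≡0)
      where
      l-witness : l witness ≡ a * μ witness
      l-witness = trans (cong (λ d → a * μ witness + d * - T) (δ-≢ {x = witness} (x∈p-y⇒x≢y witness∈D)))
                        (ℤ.+-identityʳ (a * μ witness))
    ... | inj₁ a≡0 = a≢0 a≡0
    ... | inj₂ μw≡0 = coeff-witness≢0 μw≡0

    l-expand : ∀ j → ∑[ x < n ] (l x * V x j) ≡ a * ∑[ x < n ] (μ x * V x j) + - T * V x₀ j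
    l-expand j = begin
      ∑[ x < n ] (l x * V x j)
        ≡⟨ sum-cong-≗ (λ x → distribute a (μ x) (δ x₀ x) (- T) (V x j)) ⟩
      ∑[ x < n ] (a * (μ x * V x j) + - T * (δ x₀ x * V x j))
        ≡⟨ ∑-linear a (- T) (λ x → μ x * V x j) (λ x → δ x₀ x * V x j) ⟩
      a * M + - T * ∑[ x < n ] (δ x₀ x * V x j)
        ≡⟨ cong (λ t → a * M + - T * t) (∑-δ x₀ (λ x → V x j)) ⟩
      a * M + - T * V x₀ j
        ∎
      where
      open ≡-Reasoning
      M = ∑[ x < n ] (μ x * V x j)
      distribute : ∀ a m d s v → (a * m + d * s) * v ≡ a * (m * v) + s * (d * v)
      distribute = solve-∀

    l-annihilates : ∀ j → ∑[ x < n ] (l x * V x j) ≡ 0ℤ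
    l-annihilates zero = trans (l-expand zero) (cancel a T)
      where
      cancel : ∀ a T → a * T + - T * a ≡ 0ℤ
      cancel = solve-∀
    l-annihilates (suc j) = begin
      ∑[ x < n ] (l x * V x (suc j))
        ≡⟨ l-expand (suc j) ⟩
      a * M + - T * v
        ≡⟨ swap a M T v ⟩
      a * M + - v * T
        ≡⟨ ∑-linear a (- v) (λ x → μ x * V x (suc j)) (λ x → μ x * V x zero) ⟨
      ∑[ x < n ] (a * (μ x * V x (suc j)) + - v * (μ x * V x zero))
        ≡⟨ sum-cong-≗ (λ x → expand (μ x) a (V x (suc j)) (V x zero) v) ⟨
      ∑[ x < n ] (μ x * eliminate-first-column x j)
        ≡⟨ annihilates j ⟩
      0ℤ
        ∎
      where
      open ≡-Reasoning
      M = ∑[ x < n ] (μ x * V x (suc j))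
      v = V x₀ (suc j)
      swap : ∀ a M T v → a * M + - T * v ≡ a * M + - v * T
      swap = solve-∀
      expand : ∀ m a u w v → m * (a * u ℤ.- w * v) ≡ a * (m * u) + - v * (m * w)
      expand = solve-∀

dependence : ∀ {n} k (V : Fin n → Fin k → ℤ) (D : Subset n) → k ℕ.< ∣ D ∣ → LinearDependence V D
dependence zero V D 0<∣D∣ = dependence-of-point V (proj₂ (∣p∣>0⇒nonempty D 0<∣D∣))
dependence (suc k) V D k<∣D∣ with any? (λ x → x ∈? D ×-dec ¬? (V x zero ℤ.≟ 0ℤ))
... | yes (x₀ , x₀∈D , a≢0) =
  dependence-after-elimination V x₀∈D a≢0 (dependence k _ (D - x₀) k<∣D-x₀∣)
  where
  k<∣D-x₀∣ : k ℕ.< ∣ D - x₀ ∣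
  k<∣D-x₀∣ = ℕ.s≤s⁻¹ (subst (suc k ℕ.<_) (∣p∣≡1+∣p-x∣ x₀∈D) k<∣D∣)
... | no no-pivot =
  dependence-with-zero-column V V₀≡0 (dependence k (λ x j → V x (suc j)) D (ℕ.<⇒≤ k<∣D∣))
  where
  V₀≡0 : ∀ {x} → x ∈ D → V x zero ≡ 0ℤ
  V₀≡0 {x} x∈D with V x zero ℤ.≟ 0ℤ
  ... | yes V₀≡0 = V₀≡0
  ... | no V₀≢0 = contradiction (x , x∈D , V₀≢0) no-pivot

square-nonneg : ∀ i → 0ℤ ℤ.≤ i * i
square-nonneg +0 = ℤ.≤-refl
square-nonneg +[1+ n ] = ℤ.+≤+ ℕ.z≤n
square-nonneg -[1+ n ] = ℤ.+≤+ ℕ.z≤n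

fisher-inequality : ∀ {n k} (V : Fin n → Fin k → ℤ) (D : Subset n) (c : ℕ) →
  (∀ {x y} → x ∈ D → y ∈ D → x ≢ y → ⟨ V x , V y ⟩ ≡ + c) →
  (∀ {x} → x ∈ D → + c ℤ.< ⟨ V x , V x ⟩) →
  ∣ D ∣ ℕ.≤ k
fisher-inequality {n} {k} V D c off-diagonal diagonal =
  ℕ.≮⇒≥ (λ k<∣D∣ → no-dependence (dependence k V D k<∣D∣))
  where
  gap : Fin n → ℤ
  gap y = ⟨ V y , V y ⟩ ℤ.- + c

  gap>0 : ∀ {y} → y ∈ D → 0ℤ ℤ.< gap y
  gap>0 {y} y∈D = subst (λ t → t ℤ.< gap y) (ℤ.+-inverseʳ (+ c)) (ℤ.+-monoˡ-< (- + c) (diagonal y∈D))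

  -- From a dependence l: c·S + gap_y·l_y = 0 for y ∈ D, where S = Σ l. Multiplying by S gives
  -- S·l_y ≤ 0, hence S² ≤ 0, so S = 0 and every l_y vanishes.
  no-dependence : LinearDependence V D → ⊥
  no-dependence dep = coeff-witness≢0 (l-vanishes witness∈D)
    where
    open LinearDependence dep renaming (coeff to l)
    S : ℤ
    S = ∑[ x < n ] l x

    gram-term : ∀ {y} → y ∈ D → ∀ x → l x * ⟨ V x , V y ⟩ ≡ + c * l x + gap y * (δ y x * l x)
    gram-term {y} y∈D x with x ≟ y
    ... | yes refl = diagonal-term (l x) ⟨ V x , V x ⟩ (+ c)
      where
      diagonal-term : ∀ l G c → l * G ≡ c * l + (G ℤ.- c) * (1ℤ * l)
      diagonal-term = solve-∀
    ... | no x≢y with x ∈? D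
    ...   | yes x∈D rewrite off-diagonal x∈D y∈D x≢y = off-term (l x) (+ c) (gap y)
      where
      off-term : ∀ l c g → l * c ≡ c * l + g * (0ℤ * l)
      off-term = solve-∀
    ...   | no x∉D rewrite coeff-outside x∉D = outside-term ⟨ V x , V y ⟩ (+ c) (gap y)
      where
      outside-term : ∀ G c g → 0ℤ * G ≡ c * 0ℤ + g * (0ℤ * 0ℤ)
      outside-term = solve-∀

    gram-row : ∀ {y} → y ∈ D → + c * S + gap y * l y ≡ 0ℤ
    gram-row {y} y∈D = begin
      + c * S + gap y * l y                                  ≡⟨ cong (λ t → + c * S + gap y * t) (∑-δ y l) ⟨
      + c * S + gap y * ∑[ x < n ] (δ y x * l x)             ≡⟨ ∑-linear (+ c) (gap y) l (λ x → δ y x * l x) ⟨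
      ∑[ x < n ] (+ c * l x + gap y * (δ y x * l x))         ≡⟨ sum-cong-≗ (gram-term y∈D) ⟨
      ∑[ x < n ] (l x * ⟨ V x , V y ⟩)                       ≡⟨ ∑-⟨⟩-annihilated l V annihilates (V y) ⟩
      0ℤ                                                     ∎
      where open ≡-Reasoning

    S*l≤0 : ∀ y → S * l y ℤ.≤ 0ℤ
    S*l≤0 y with y ∈? D
    ... | no y∉D = ℤ.≤-reflexive (trans (cong (S *_) (coeff-outside y∉D)) (ℤ.*-zeroʳ S))
    ... | yes y∈D = ℤ.*-cancelˡ-≤-pos (S * l y) 0ℤ (gap y) {{ℤ.positive (gap>0 y∈D)}} (begin
      gap y * (S * l y)                             ≡⟨ multiply-row (+ c) S (gap y) (l y) ⟩
      S * (+ c * S + gap y * l y) ℤ.- + c * (S * S) ≡⟨ cong (λ t → S * t ℤ.- + c * (S * S)) (gram-row y∈D) ⟩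
      S * 0ℤ ℤ.- + c * (S * S)                      ≡⟨ vanish S (+ c * (S * S)) ⟩
      - (+ c * (S * S))                             ≤⟨ ℤ.neg-mono-≤ (ℤ.*-monoˡ-≤-nonNeg (+ c) (square-nonneg S)) ⟩
      - (+ c * 0ℤ)                                  ≡⟨ cong -_ (ℤ.*-zeroʳ (+ c)) ⟩
      0ℤ                                            ≡⟨ ℤ.*-zeroʳ (gap y) ⟨
      gap y * 0ℤ                                    ∎)
      where
      open ℤ.≤-Reasoning
      multiply-row : ∀ c S g l → g * (S * l) ≡ S * (c * S + g * l) ℤ.- c * (S * S)
      multiply-row = solve-∀
      vanish : ∀ S t → S * 0ℤ ℤ.- t ≡ - t
      vanish = solve-∀

    S≡0 : S ≡ 0ℤ
    S≡0 = [ id , id ]′ (ℤ.i*j≡0⇒i≡0∨j≡0 S (ℤ.≤-antisym S*S≤0 (square-nonneg S)))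
      where
      S*S≤0 : S * S ℤ.≤ 0ℤ
      S*S≤0 = ℤ.≤-trans (ℤ.≤-reflexive (*-distribˡ-sum S l)) (∑-nonpos (λ y → S * l y) S*l≤0)

    l-vanishes : ∀ {y} → y ∈ D → l y ≡ 0ℤ
    l-vanishes {y} y∈D with ℤ.i*j≡0⇒i≡0∨j≡0 (gap y) gap*l≡0
      where
      gap*l≡0 : gap y * l y ≡ 0ℤ
      gap*l≡0 = begin
        gap y * l y             ≡⟨ ℤ.+-identityˡ (gap y * l y) ⟨
        0ℤ + gap y * l y        ≡⟨ cong (_+ gap y * l y) (ℤ.*-zeroʳ (+ c)) ⟨
        + c * 0ℤ + gap y * l y  ≡⟨ cong (λ t → + c * t + gap y * l y) S≡0 ⟨
        + c * S + gap y * l y   ≡⟨ gram-row y∈D ⟩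
        0ℤ                      ∎
        where open ≡-Reasoning
    ... | inj₁ gap≡0 = contradiction (sym gap≡0) (ℤ.<⇒≢ (gap>0 y∈D))
    ... | inj₂ l≡0 = l≡0

indicator : ∀ {k} → Subset k → Fin k → ℤ
indicator p j = if lookup p j then 1ℤ else 0ℤ

⟨indicator⟩≡∣∩∣ : ∀ {k} (p q : Subset k) → ⟨ indicator p , indicator q ⟩ ≡ + ∣ p ∩ q ∣
⟨indicator⟩≡∣∩∣ [] [] = refl
⟨indicator⟩≡∣∩∣ (true ∷ p) (true ∷ q) = cong (λ t → 1ℤ + t) (⟨indicator⟩≡∣∩∣ p q)
⟨indicator⟩≡∣∩∣ (true ∷ p) (false ∷ q) = cong (λ t → 0ℤ + t) (⟨indicator⟩≡∣∩∣ p q)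
⟨indicator⟩≡∣∩∣ (false ∷ p) (_ ∷ q) = cong (λ t → 0ℤ + t) (⟨indicator⟩≡∣∩∣ p q)

RowsAgree : ∀ {a} {A : Set a} {n} → (Fin n → Fin n → A) → Fin n → Fin n → Set a
RowsAgree f x y = ∀ z → z ≢ x → z ≢ y → f x z ≡ f y z

module _ {a} {A : Set a} {n} {f : Fin n → Fin n → A} (f-sym : ∀ x y → f x y ≡ f y x) where

  rowsAgree-via : ∀ {r x y} → RowsAgree f r x → RowsAgree f r y → RowsAgree f x y
  rowsAgree-via {r} {x} {y} r~x r~y z z≢x z≢y with z ≟ r
  ... | no z≢r = trans (sym (r~x z z≢r z≢x)) (r~y z z≢r z≢y)
  ... | yes refl with x ≟ y
  ...   | yes refl = refl
  ...   | no x≢y = begin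
    f x z ≡⟨ f-sym x z ⟩
    f z x ≡⟨ r~y x (≢-sym z≢x) x≢y ⟩
    f y x ≡⟨ f-sym y x ⟩
    f x y ≡⟨ r~x y (≢-sym z≢y) (≢-sym x≢y) ⟨
    f z y ≡⟨ f-sym z y ⟩
    f y z ∎
    where open ≡-Reasoning

  rowsAgree⇒≡ : ∀ {D : Subset n} → (∀ {x y} → x ∈ D → y ∈ D → RowsAgree f x y) →
    ∀ {u v x y} → u ∈ D → v ∈ D → x ∈ D → y ∈ D → u ≢ v → x ≢ y → f u v ≡ f x y
  rowsAgree⇒≡ agree {u} {v} {x} {y} u∈D v∈D x∈D y∈D u≢v x≢y with x ≟ v
  ... | no x≢v = begin
    f u v ≡⟨ agree u∈D x∈D v (≢-sym u≢v) (≢-sym x≢v) ⟩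
    f x v ≡⟨ f-sym x v ⟩
    f v x ≡⟨ agree v∈D y∈D x x≢v x≢y ⟩
    f y x ≡⟨ f-sym y x ⟩
    f x y ∎
    where open ≡-Reasoning
  ... | yes refl = trans (agree u∈D y∈D x (≢-sym u≢v) x≢y) (f-sym y x)

common : ∀ {n k} → (Fin n → Subset k) → Fin n → Fin n → ℕ
common sig x y = ∣ sig x ∩ sig y ∣

module _ {n k} (sig : Fin n → Subset k) (D : Subset n)
  (agree : ∀ {x y} → x ∈ D → y ∈ D → RowsAgree (common sig) x y)
  (no-singleton : ∀ {j y} → j ∈ sig y → ∃ λ z → z ≢ y × j ∈ sig z) where

  ⊆⇒≡ : ∀ {x y} → x ∈ D → y ∈ D → sig x ⊆ sig y → sig x ≡ sig y
  ⊆⇒≡ {x} {y} x∈D y∈D sx⊆sy = ⊆-antisym sx⊆sy sy⊆sx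
    where
    sy⊆sx : sig y ⊆ sig x
    sy⊆sx {j} j∈sy with j ∈? sig x
    ... | yes j∈sx = j∈sx
    ... | no j∉sx with no-singleton j∈sy
    ...   | z , z≢y , j∈sz = contradiction (agree x∈D y∈D z z≢x z≢y) (ℕ.<⇒≢ common-x<common-y)
      where
      z≢x : z ≢ x
      z≢x refl = j∉sx j∈sz
      common-x<common-y : common sig x z < common sig y z
      common-x<common-y = p⊂q⇒∣p∣<∣q∣
        (p⊆q⇒p∩r⊆q∩r (sig z) sx⊆sy , j , x∈p∩q⁺ (j∈sy , j∈sz) , j∉sx ∘ proj₁ ∘ x∈p∩q⁻ (sig x) (sig z))

  module _ {r s} (r∈D : r ∈ D) (s∈D : s ∈ D) (r≢s : r ≢ s) where

    private
      c : ℕ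
      c = common sig r s

    common-constant : ∀ {x y} → x ∈ D → y ∈ D → x ≢ y → common sig x y ≡ c
    common-constant x∈D y∈D x≢y =
      rowsAgree⇒≡ (λ x y → cong ∣_∣ (∩-comm (sig x) (sig y))) agree x∈D y∈D r∈D s∈D x≢y r≢s

    signatures-equal : k < ∣ D ∣ → ∀ {x y} → x ∈ D → y ∈ D → sig x ≡ sig y
    signatures-equal k<∣D∣ {x} {y} x∈D y∈D with any? (λ x → x ∈? D ×-dec ∣ sig x ∣ ≤? c)
    ... | yes (x₀ , x₀∈D , ∣sx₀∣≤c) = trans (sym (minimal x∈D)) (minimal y∈D)
      where
      minimal : ∀ {y} → y ∈ D → sig x₀ ≡ sig y
      minimal {y} y∈D with x₀ ≟ y
      ... | yes refl = refl
      ... | no x₀≢y = ⊆⇒≡ x₀∈D y∈D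
              (∣p∣≤∣p∩q∣⇒p⊆q (ℕ.≤-trans ∣sx₀∣≤c (ℕ.≤-reflexive (sym (common-constant x₀∈D y∈D x₀≢y)))))
    ... | no ∄small = contradiction (fisher-inequality (indicator ∘ sig) D c gram-off gram-diag) (ℕ.<⇒≱ k<∣D∣)
      where
      gram-off : ∀ {x y} → x ∈ D → y ∈ D → x ≢ y → ⟨ indicator (sig x) , indicator (sig y) ⟩ ≡ + c
      gram-off {x} {y} x∈D y∈D x≢y =
        trans (⟨indicator⟩≡∣∩∣ (sig x) (sig y)) (cong +_ (common-constant x∈D y∈D x≢y))
      gram-diag : ∀ {x} → x ∈ D → + c ℤ.< ⟨ indicator (sig x) , indicator (sig x) ⟩
      gram-diag {x} x∈D rewrite ⟨indicator⟩≡∣∩∣ (sig x) (sig x) | ∩-idem (sig x) =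
        ℤ.+<+ (ℕ.≰⇒> λ ∣sx∣≤c → ∄small (x , x∈D , ∣sx∣≤c))

signature : ∀ {n k} → (Fin k → Subset n) → Fin n → Subset k
signature C x = tabulate (λ j → lookup (C j) x)

∈-signature⁻ : ∀ {n k} {C : Fin k → Subset n} {x j} → j ∈ signature C x → x ∈ C j
∈-signature⁻ {C = C} {x} {j} j∈sx =
  lookup⇒[]= x (C j) (trans (sym (lookup∘tabulate (λ j → lookup (C j) x) j)) ([]=⇒lookup j∈sx))

∈-signature⁺ : ∀ {n k} {C : Fin k → Subset n} {x j} → x ∈ C j → j ∈ signature C x
∈-signature⁺ {C = C} {x} {j} x∈Cj =
  lookup⇒[]= j (signature C x) (trans (lookup∘tabulate (λ j → lookup (C j) x) j) ([]=⇒lookup x∈Cj))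

tabulate-∩ : ∀ {k} (f g : Fin k → Bool) → tabulate f ∩ tabulate g ≡ tabulate (λ j → f j ∧ g j)
tabulate-∩ {zero} f g = refl
tabulate-∩ {suc k} f g = cong (f zero ∧ g zero ∷_) (tabulate-∩ (f ∘ suc) (g ∘ suc))

module _ {n} (I : Instance n) where
  open Instance I

  weight : Fin n → Fin n → ℕ
  weight u v = if adj u v then w u v else 0

  weight-sym : ∀ u v → weight u v ≡ weight v u
  weight-sym u v rewrite adj-sym u v | w-sym u v = refl

  A-off-diagonal : ∀ {u v} → u ≢ v → A I u v ≡ just (weight u v)
  A-off-diagonal {u} {v} u≢v with u ≟ v
  ... | yes u≡v = contradiction u≡v u≢v
  ... | no _ with adj u v
  ...   | true = refl
  ...   | false = refl

  starTwins⇒rowsAgree : ∀ {u v} → StarTwins I u v → RowsAgree weight u v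
  starTwins⇒rowsAgree {u} {v} (_ , _ , rows≐⋆) z z≢u z≢v with rows≐⋆ z
  ... | inj₁ Auz≡Avz = just-injective (trans (sym Auz) (trans Auz≡Avz Avz))
    where
    Auz = A-off-diagonal (≢-sym z≢u)
    Avz = A-off-diagonal (≢-sym z≢v)
  ... | inj₂ (inj₁ Auz≡⋆) = contradiction (trans (sym (A-off-diagonal (≢-sym z≢u))) Auz≡⋆) λ ()
  ... | inj₂ (inj₂ Avz≡⋆) = contradiction (trans (sym (A-off-diagonal (≢-sym z≢v))) Avz≡⋆) λ ()

  block-rowsAgree : ∀ {D} → IsBlock I D → ∀ {x y} → x ∈ D → y ∈ D → RowsAgree weight x y
  block-rowsAgree {D} (r , member) x∈D y∈D = rowsAgree-via weight-sym (from-root x∈D) (from-root y∈D)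
    where
    from-root : ∀ {x} → x ∈ D → RowsAgree weight r x
    from-root {x} x∈D with proj₁ (member x) ([]=⇒lookup x∈D)
    ... | inj₁ refl = λ _ _ _ → refl
    ... | inj₂ twins = starTwins⇒rowsAgree twins

  module _ {k} (C : Fin k → Subset n)
    (cliques : ∀ j → IsClique I (C j))
    (no-singletons : ∀ j → ∣ C j ∣ ≢ 1)
    (edge-weights : ∀ u v → adj u v ≡ true → both I C u v ≡ w u v) where

    common≡weight : ∀ {u v} → u ≢ v → common (signature C) u v ≡ weight u v
    common≡weight {u} {v} u≢v with adj u v in uv
    ... | true = trans (cong ∣_∣ (tabulate-∩ (λ j → lookup (C j) u) (λ j → lookup (C j) v))) (edge-weights u v uv)
    ... | false = trans (cong ∣_∣ (Empty-unique disjoint)) (∣⊥∣≡0 k)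
      where
      disjoint : Empty (signature C u ∩ signature C v)
      disjoint (j , j∈su∩sv) with x∈p∩q⁻ (signature C u) (signature C v) j∈su∩sv
      ... | j∈su , j∈sv = contradiction (trans (sym uv) (cliques j u v u≢v (member j∈su) (member j∈sv))) λ ()
        where
        member : ∀ {x} → j ∈ signature C x → lookup (C j) x ≡ true
        member = []=⇒lookup ∘ ∈-signature⁻ {C = C}

    signature-not-singleton : ∀ {j y} → j ∈ signature C y → ∃ λ z → z ≢ y × j ∈ signature C z
    signature-not-singleton {j} j∈sy with ∃-other-element (∈-signature⁻ {C = C} j∈sy) (no-singletons j)
    ... | z , z∈Cj , z≢y = z , z≢y , ∈-signature⁺ {C = C} z∈Cj

    block-signatures-agree : ∀ {D} → IsBlock I D →
      ∀ {x y} → x ∈ D → y ∈ D → RowsAgree (common (signature C)) x y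
    block-signatures-agree block {x} {y} x∈D y∈D z z≢x z≢y = begin
      common (signature C) x z ≡⟨ common≡weight (≢-sym z≢x) ⟩
      weight x z               ≡⟨ block-rowsAgree block x∈D y∈D z z≢x z≢y ⟩
      weight y z               ≡⟨ common≡weight (≢-sym z≢y) ⟨
      common (signature C) y z ∎
      where open ≡-Reasoning

theorem4p5 : ∀ {n : ℕ} (I : Instance n) (k : ℕ) → 1 ≤ k → NoIsolated I →
    (D : Subset n) → IsBlock I D → suc k ≤ ∣ D ∣ →
    YES I k → Identical I k D
theorem4p5 I k 1≤k _ D block@(r , member) k<∣D∣ _ C (cliques , no-singletons , edge-weights , _) u v u∈D v∈D j =
  begin
  lookup (C j) u           ≡⟨ lookup∘tabulate (λ j → lookup (C j) u) j ⟨
  lookup (signature C u) j ≡⟨ cong (λ p → lookup p j) signature-u≡v ⟩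
  lookup (signature C v) j ≡⟨ lookup∘tabulate (λ j → lookup (C j) v) j ⟩
  lookup (C j) v           ∎
  where
  open ≡-Reasoning
  r∈D : r ∈ D
  r∈D = lookup⇒[]= r D (proj₂ (member r) (inj₁ refl))
  ∣D∣≢1 : ∣ D ∣ ≢ 1
  ∣D∣≢1 = ≢-sym (ℕ.<⇒≢ (ℕ.≤-trans (ℕ.s≤s 1≤k) k<∣D∣))
  signature-u≡v : signature C u ≡ signature C v
  signature-u≡v with ∃-other-element r∈D ∣D∣≢1
  ... | s , s∈D , s≢r =
    signatures-equal (signature C) D
      (block-signatures-agree I C cliques no-singletons edge-weights block)
      (signature-not-singleton I C cliques no-singletons edge-weights)
      r∈D s∈D (≢-sym s≢r) k<∣D∣ (lookup⇒[]= u D u∈D) (lookup⇒[]= v D v∈D)
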